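{- Let $H$ be a standard finitary set functor with a reduced presentation $\varepsilon\colon H_\Sigma\to H$, let $Y$ be a set, and suppose that the free corecursive $H$-algebra $(CY,\psi_Y)$ on $Y$, with universal map $\eta^C_Y\colon Y\to CY$, is a cia for $H$. Let $e\colon X\to H_\Sigma X+Y$ be any map with unique solution $e^{\ddagger}\colon X\to T_\Sigma Y$ in the free cia for $H_\Sigma$, and form \[\bar e=(\varepsilon_X+\eta^C_Y)\cdot e\colon X\to HX+CY,\] with unique solution $\bar e^\dagger\colon X\to CY$. Then \[m_Y\cdot\bar e^\dagger=\hat\varepsilon_Y\cdot e^{\ddagger}\colon X\to TY.\]
   Context: Finitary set functor: $HX=\bigcup HY$ over finite $Y\subseteq X$; standard: preserves inclusions and finite intersections. $H_\Sigma X=\coprod_n\Sigma_n\times X^n$ for a finitary signature $\Sigma$; a presentation is a natural transformation $\varepsilon\colon H_\Sigma\to H$ with surjective components; it is reduced if for every $\varepsilon$-equation $\sigma(x_1,\dots,x_n)=\tau(z_1,\dots,z_m)$ (meaning $\varepsilon_X$ identifies these elements for $X$ the set of variables), pairwise distinct $x_i$ all lie among the $z_j$, and if moreover the $z_j$ are pairwise distinct then $\sigma=\tau$. For an endofunctor $G$ and $G$-algebra $a\colon GA\to A$: $a$ is a cia if every $e\colon X\to GX+A$ has a unique solution $e^\dagger\colon X\to A$, $e^\dagger=[a,\mathrm{id}_A]\cdot(Ge^\dagger+\mathrm{id}_A)\cdot e$; $a$ is corecursive if every coalgebra $e\colon X\to GX$ has a unique $e^\dagger$ with $e^\dagger=a\cdot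 Ge^\dagger\cdot e$. $T_\Sigma Y$ is the $\Sigma$-algebra of all (possibly infinite) $\Sigma$-trees over $Y$ with tree-tupling structure $\tau^\Sigma_Y\colon H_\Sigma T_\Sigma Y\to T_\Sigma Y$ and $\eta^\Sigma_Y\colon Y\to T_\Sigma Y$ the leaf map; it is the free cia for $H_\Sigma$ on $Y$, and $e^\ddagger$ is the unique map with $e^\ddagger=[\tau^\Sigma_Y,\eta^\Sigma_Y]\cdot(H_\Sigma e^\ddagger+\mathrm{id}_Y)\cdot e$. $TY$ is the terminal coalgebra of $H(-)+Y$, with inverse structure $[\tau_Y,\eta_Y]\colon HTY+Y\to TY$; $(TY,\tau_Y)$ with $\eta_Y$ is the free cia for $H$ on $Y$. $\hat\varepsilon_Y\colon T_\Sigma Y\to TY$ is the canonical quotient map (with $TY\cong T_\Sigma Y/{\sim^*_Y}$, the quotient modulo application of $\varepsilon$-equations); it is the $H_\Sigma$-algebra morphism from $(T_\Sigma Y,\tau^\Sigma_Y)$ to $(TY,\tau_Y\cdot\varepsilon_{TY})$ with $\hat\varepsilon_Y\cdot\eta^\Sigma_Y=\eta_Y$. $m_Y\colon CY\to TY$ is the unique $H$-algebra morphism with $m_Y\cdot\eta^C_Y=\eta_Y$. -}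

module Defs where

open import Data.Nat using (ℕ)
open import Data.Fin using (Fin)
open import Data.Vec using (Vec; lookup)
import Data.Vec as Vec
open import Data.Vec.Properties using (map-id; map-∘; map-cong)
open import Data.Vec.Membership.Propositional using (_∈_)
open import Data.Product using (Σ; _×_; _,_; proj₁; proj₂)
open import Data.Sum using (_⊎_; inj₁; inj₂; [_,_]′)
import Data.Sum as Sum
open import Function using (id; _∘_; Injective; Surjective)
open import Relation.Binary.PropositionalEquality using (_≡_; refl; cong)

record SetFunctor : Set₁ where
  field
    F₀     : Set → Set
    map    : {A B : Set} → (A → B) → F₀ A → F₀ B
    map-cong′ : {A B : Set} {f g : A → B} → (∀ x → f x ≡ g x) → ∀ t → map f t ≡ map g t
    map-id′   : {A : Set} (t : F₀ A) → map id t ≡ t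
    map-∘′    : {A B C : Set} (f : B → C) (g : A → B) (t : F₀ A) →
                map (f ∘ g) t ≡ map f (map g t)

open SetFunctor public

-- Finitary: every element of HX lies in (the image of) HY for a finite Y ⊆ X,
-- i.e. factors through H applied to a map from a finite set.
Finitary : SetFunctor → Set₁
Finitary H = ∀ (X : Set) (t : F₀ H X) →
  Σ ℕ λ n → Σ (Fin n → X) λ v → Σ (F₀ H (Fin n)) λ s → map H v s ≡ t

-- Standard: preserves inclusions (injections) and finite intersections
-- (intersections of two subobjects, i.e. pullbacks of pairs of injections).
PreservesInclusions : SetFunctor → Set₁
PreservesInclusions H = ∀ {A X : Set} (f : A → X) → Injective _≡_ _≡_ f →
  Injective _≡_ _≡_ (map H f)

Meet : {A B X : Set} → (A → X) → (B → X) → Set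
Meet {A} {B} f g = Σ A λ a → Σ B λ b → f a ≡ g b

meet₁ : {A B X : Set} {f : A → X} {g : B → X} → Meet f g → A
meet₁ (a , _ , _) = a

meet₂ : {A B X : Set} {f : A → X} {g : B → X} → Meet f g → B
meet₂ (_ , b , _) = b

PreservesIntersections : SetFunctor → Set₁
PreservesIntersections H = ∀ {A B X : Set} (f : A → X) (g : B → X) →
  Injective _≡_ _≡_ f → Injective _≡_ _≡_ g →
  ∀ (u : F₀ H A) (v : F₀ H B) → map H f u ≡ map H g v →
  Σ (F₀ H (Meet f g)) λ w → (map H meet₁ w ≡ u) × (map H meet₂ w ≡ v)

Standard : SetFunctor → Set₁
Standard H = PreservesInclusions H × PreservesIntersections H

Signature : Set₁
Signature = ℕ → Set

H[_] : Signature → SetFunctor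
H[ Σₛ ] = record
  { F₀ = λ X → Σ ℕ λ n → Σₛ n × Vec X n
  ; map = λ f → λ { (n , σ , xs) → n , σ , Vec.map f xs }
  ; map-cong′ = λ { p (n , σ , xs) → cong (λ ys → n , σ , ys) (map-cong p xs) }
  ; map-id′ = λ { (n , σ , xs) → cong (λ ys → n , σ , ys) (map-id xs) }
  ; map-∘′ = λ { f g (n , σ , xs) → cong (λ ys → n , σ , ys) (map-∘ f g xs) }
  }

record NatTrans (F G : SetFunctor) : Set₁ where
  field
    component : (X : Set) → F₀ F X → F₀ G X
    natural   : {X Y : Set} (f : X → Y) (t : F₀ F X) →
                component Y (map F f t) ≡ map G f (component X t)

open NatTrans public

IsPresentation : (Σₛ : Signature) (H : SetFunctor) → NatTrans H[ Σₛ ] H → Set₁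
IsPresentation Σₛ H ε = ∀ (X : Set) → Surjective _≡_ _≡_ (component ε X)

Distinct : {X : Set} {n : ℕ} → Vec X n → Set
Distinct xs = ∀ i j → lookup xs i ≡ lookup xs j → i ≡ j

Reduced : (Σₛ : Signature) (H : SetFunctor) → NatTrans H[ Σₛ ] H → Set₁
Reduced Σₛ H ε = ∀ (X : Set) (n : ℕ) (σ : Σₛ n) (xs : Vec X n)
                   (m : ℕ) (τ : Σₛ m) (zs : Vec X m) →
  component ε X (n , σ , xs) ≡ component ε X (m , τ , zs) →
  Distinct xs →
  (∀ i → lookup xs i ∈ zs) ×
  (Distinct zs → _≡_ {A = Σ ℕ Σₛ} (n , σ) (m , τ))

SolvesVia : (G : SetFunctor) {A X Y : Set} (a : F₀ G A → A) (η : Y → A) →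
            (X → F₀ G X ⊎ Y) → (X → A) → Set
SolvesVia G a η e s = ∀ x → s x ≡ [ (λ t → a (map G s t)) , η ]′ (e x)

Solves : (G : SetFunctor) {A X : Set} (a : F₀ G A → A) →
         (X → F₀ G X ⊎ A) → (X → A) → Set
Solves G a e s = SolvesVia G a id e s

IsCia : (G : SetFunctor) {A : Set} → (F₀ G A → A) → Set₁
IsCia G {A} a = ∀ (X : Set) (e : X → F₀ G X ⊎ A) →
  Σ (X → A) λ s → Solves G a e s × (∀ s′ → Solves G a e s′ → ∀ x → s′ x ≡ s x)

CoSolves : (G : SetFunctor) {A X : Set} (a : F₀ G A → A) →
           (X → F₀ G X) → (X → A) → Set
CoSolves G a e s = ∀ x → s x ≡ a (map G s (e x))

IsCorecursive : (G : SetFunctor) {A : Set} → (F₀ G A → A) → Set₁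
IsCorecursive G {A} a = ∀ (X : Set) (e : X → F₀ G X) →
  Σ (X → A) λ s → CoSolves G a e s × (∀ s′ → CoSolves G a e s′ → ∀ x → s′ x ≡ s x)

IsAlgHom : (G : SetFunctor) {A B : Set} → (F₀ G A → A) → (F₀ G B → B) → (A → B) → Set
IsAlgHom G a b h = ∀ t → h (a t) ≡ b (map G h t)

IsFreeCia : (G : SetFunctor) (Y : Set) {A : Set} → (F₀ G A → A) → (Y → A) → Set₁
IsFreeCia G Y {A} a η = IsCia G a ×
  (∀ (B : Set) (b : F₀ G B → B) → IsCia G b → (f : Y → B) →
     Σ (A → B) λ h → IsAlgHom G a b h × (∀ y → h (η y) ≡ f y) ×
       (∀ h′ → IsAlgHom G a b h′ → (∀ y → h′ (η y) ≡ f y) → ∀ x → h′ x ≡ h x))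

IsFreeCorecursive : (G : SetFunctor) (Y : Set) {A : Set} → (F₀ G A → A) → (Y → A) → Set₁
IsFreeCorecursive G Y {A} a η = IsCorecursive G a ×
  (∀ (B : Set) (b : F₀ G B → B) → IsCorecursive G b → (f : Y → B) →
     Σ (A → B) λ h → IsAlgHom G a b h × (∀ y → h (η y) ≡ f y) ×
       (∀ h′ → IsAlgHom G a b h′ → (∀ y → h′ (η y) ≡ f y) → ∀ x → h′ x ≡ h x))

IsTerminalCoalgebraInverse : (G : SetFunctor) (Y : Set) {T : Set} →
  (F₀ G T → T) → (Y → T) → Set₁
IsTerminalCoalgebraInverse G Y {T} τ η =
  Σ (T → F₀ G T ⊎ Y) λ out →
    (∀ u → out ([ τ , η ]′ u) ≡ u) × (∀ t → [ τ , η ]′ (out t) ≡ t) ×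
    (∀ (X : Set) (c : X → F₀ G X ⊎ Y) →
       Σ (X → T) λ h → (∀ x → out (h x) ≡ Sum.map (map G h) id (c x)) ×
         (∀ h′ → (∀ x → out (h′ x) ≡ Sum.map (map G h′) id (c x)) → ∀ x → h′ x ≡ h x))

module Submission where

-- Both m · ē† and ε̂ · e‡ solve the single H-equation (ε_X + id) · e : X → HX + Y
-- in the cia (T, τ) with generators η: the first because m is an H-algebra morphism
-- fixing generators, the second because ε̂ is an H_Σ-algebra morphism into
-- (T, τ · ε_T) and ε is natural. Solutions in a cia are unique.

open import Defs
open import Data.Product using (proj₁; proj₂)
open import Data.Sum using (_⊎_; inj₁; inj₂)
import Data.Sum as Sum
open import Function using (id; _∘_)
open import Relation.Binary.PropositionalEquality
  using (_≡_; sym; trans; cong; module ≡-Reasoning)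

module _ (G : SetFunctor) {A X Y : Set} (a : F₀ G A → A) where

  solvesVia⇒solves : {f : Y → A} (e : X → F₀ G X ⊎ Y) {s : X → A} →
    SolvesVia G a f e s → Solves G a (Sum.map id f ∘ e) s
  solvesVia⇒solves e sol x with e x | sol x
  ... | inj₁ _ | p = p
  ... | inj₂ _ | p = p

  solves-map⇒solvesVia : {Z : Set} (g : Z → F₀ G X) (f : Y → A)
    (e : X → Z ⊎ Y) {s : X → A} →
    Solves G a (Sum.map g f ∘ e) s → SolvesVia G a f (Sum.map g id ∘ e) s
  solves-map⇒solvesVia g f e sol x with e x | sol x
  ... | inj₁ _ | p = p
  ... | inj₂ _ | p = p

  solvesVia-resp-generators : {f g : Y → A} (e : X → F₀ G X ⊎ Y) {s : X → A} →
    (∀ y → f y ≡ g y) → SolvesVia G a f e s → SolvesVia G a g e s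
  solvesVia-resp-generators e f≗g sol x with e x | sol x
  ... | inj₁ _ | p = p
  ... | inj₂ y | p = trans p (f≗g y)

  solvesVia-unique : IsCia G a → (f : Y → A) (e : X → F₀ G X ⊎ Y) {s s′ : X → A} →
    SolvesVia G a f e s → SolvesVia G a f e s′ → ∀ x → s x ≡ s′ x
  solvesVia-unique cia f e sol sol′ x =
    trans (unique _ (solvesVia⇒solves e sol) x) (sym (unique _ (solvesVia⇒solves e sol′) x))
    where unique = proj₂ (proj₂ (cia X (Sum.map id f ∘ e)))

algHom-solvesVia : (G : SetFunctor) {A B X Y : Set}
  (a : F₀ G A → A) (b : F₀ G B → B) (h : A → B) → IsAlgHom G a b h →
  {f : Y → A} (e : X → F₀ G X ⊎ Y) {s : X → A} →
  SolvesVia G a f e s → SolvesVia G b (h ∘ f) e (h ∘ s)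
algHom-solvesVia G a b h hom e {s} sol x with e x | sol x
... | inj₂ _ | p = cong h p
... | inj₁ t | p = begin
  h (s x)                     ≡⟨ cong h p ⟩
  h (a (map G s t))           ≡⟨ hom (map G s t) ⟩
  b (map G h (map G s t))     ≡⟨ cong b (sym (map-∘′ G h s t)) ⟩
  b (map G (h ∘ s) t)         ∎
  where open ≡-Reasoning

solvesVia-along-natTrans : {F G : SetFunctor} (ε : NatTrans F G) {B X Y : Set}
  (b : F₀ G B → B) {f : Y → B} (e : X → F₀ F X ⊎ Y) {s : X → B} →
  SolvesVia F (b ∘ component ε B) f e s →
  SolvesVia G b f (Sum.map (component ε X) id ∘ e) s
solvesVia-along-natTrans ε b e {s} sol x with e x | sol x
... | inj₂ _ | p = p
... | inj₁ t | p = trans p (cong b (natural ε s t))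

lemma6p12 : (H : SetFunctor) → Finitary H → Standard H →
    (Σₛ : Signature) (ε : NatTrans H[ Σₛ ] H) →
    IsPresentation Σₛ H ε → Reduced Σₛ H ε →
    (Y : Set) →
    (TΣ : Set) (τΣ : F₀ H[ Σₛ ] TΣ → TΣ) (ηΣ : Y → TΣ) →
    IsFreeCia H[ Σₛ ] Y τΣ ηΣ →
    (T : Set) (τ : F₀ H T → T) (η : Y → T) →
    IsTerminalCoalgebraInverse H Y τ η → IsFreeCia H Y τ η →
    (C : Set) (ψ : F₀ H C → C) (ηC : Y → C) →
    IsFreeCorecursive H Y ψ ηC → IsCia H ψ →
    (ε̂ : TΣ → T) → IsAlgHom H[ Σₛ ] τΣ (τ ∘ component ε T) ε̂ →
    (∀ y → ε̂ (ηΣ y) ≡ η y) →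
    (m : C → T) → IsAlgHom H ψ τ m → (∀ y → m (ηC y) ≡ η y) →
    (X : Set) (e : X → F₀ H[ Σₛ ] X ⊎ Y) →
    (e‡ : X → TΣ) → SolvesVia H[ Σₛ ] τΣ ηΣ e e‡ →
    (ē† : X → C) → Solves H ψ (Sum.map (component ε X) ηC ∘ e) ē† →
    ∀ x → m (ē† x) ≡ ε̂ (e‡ x)
lemma6p12 H _ _ Σₛ ε _ _ Y TΣ τΣ ηΣ _ T τ η _ freeCiaT C ψ ηC _ _
          ε̂ ε̂-hom ε̂-η m m-hom m-η X e e‡ e‡-sol ē† ē†-sol =
  solvesVia-unique H τ (proj₁ freeCiaT) η e′ m·ē†-sol ε̂·e‡-sol
  where
  e′ : X → F₀ H X ⊎ Y
  e′ = Sum.map (component ε X) id ∘ e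

  m·ē†-sol : SolvesVia H τ η e′ (m ∘ ē†)
  m·ē†-sol = solvesVia-resp-generators H τ e′ m-η
    (algHom-solvesVia H ψ τ m m-hom e′
      (solves-map⇒solvesVia H ψ (component ε X) ηC e ē†-sol))

  ε̂·e‡-sol : SolvesVia H τ η e′ (ε̂ ∘ e‡)
  ε̂·e‡-sol = solvesVia-resp-generators H τ e′ ε̂-η
    (solvesVia-along-natTrans ε τ e
      (algHom-solvesVia H[ Σₛ ] τΣ (τ ∘ component ε T) ε̂ ε̂-hom e e‡-sol))
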